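{- Let $n\ge 6$ be even and let $L$ be a Latin square of order $n$ with inner distance $\frac n2-1$. If some row of $L$ has extended difference row equal to Row A, then $L$ is a row product.
   Context: Entries of $L$ are $m_{i,j}\in[1,n]$, each row and column containing every symbol once. $\mathrm{dist}(a,b)$ is the minimum of the residues in $[0,n-1]$ of $a-b$ and $b-a$ mod $n$; the inner distance is the minimum $\mathrm{dist}$ over horizontally or vertically adjacent cells. For a row $(s_1,\dots,s_n)$ let $h_j\in[0,n-1]$, $h_j\equiv s_{j+1}-s_j$ ($j\le n-1$), $h_n\in[0,n-1]$, $h_n\equiv s_1-s_n$; its extended difference row is $(\epsilon_1,\dots,\epsilon_{n-1},h)$ with $\epsilon_j=h_j-\frac n2$, $h=h_n-\frac n2$ (integers). Row A is $(0,1,0,1,\dots,1,0,1-\frac n2)$, whose first $n-1$ entries alternate $0,1$ beginning and ending with $0$. With $H$ the $n\times(n-1)$ matrix $h_{i,j}\in[0,n-1]$, $h_{i,j}\equiv m_{i,j+1}-m_{i,j}\pmod n$, $L$ is a row product if all rows of $H$ are equal (equivalently $m_{i,j}\equiv s+\sum_{k<i}b_k+\sum_{k<j}a_k\pmod n$ for difference rows $(a_k),(b_k)$ of Latin rows and a constant $s$). -}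

module Defs where

open import Data.Nat using (ℕ; zero; suc; _≤_; _<?_; _%_; _∸_; _⊓_)
open import Data.Integer using (ℤ; +_; _-_)
open import Data.Integer.DivMod using (_%ℕ_)
open import Data.Fin using (Fin; toℕ; fromℕ<; zero)
open import Data.Product using (Σ; _×_; ∃; ∃-syntax)
open import Data.Sum using (_⊎_)
open import Relation.Nullary using (yes; no)
open import Relation.Binary.PropositionalEquality using (_≡_)

Square : ℕ → Set
Square n = Fin n → Fin n → ℕ

IsLatin : (n : ℕ) → Square n → Set
IsLatin n m =
  (∀ i j → 1 ≤ m i j × m i j ≤ n) ×
  (∀ i s → 1 ≤ s → s ≤ n →
     Σ (Fin n) λ j → m i j ≡ s × (∀ j' → m i j' ≡ s → j' ≡ j)) ×
  (∀ j s → 1 ≤ s → s ≤ n →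
     Σ (Fin n) λ i → m i j ≡ s × (∀ i' → m i' j ≡ s → i' ≡ i))

resid : ℕ → ℕ → ℕ → ℕ
resid zero    a b = 0
resid (suc k) a b = ((+ a) - (+ b)) %ℕ suc k

dist : ℕ → ℕ → ℕ → ℕ
dist n a b = resid n a b ⊓ resid n b a

Adjacent : {n : ℕ} → Fin n → Fin n → Fin n → Fin n → Set
Adjacent i j i' j' =
  (i ≡ i' × toℕ j' ≡ suc (toℕ j)) ⊎ (j ≡ j' × toℕ i' ≡ suc (toℕ i))

InnerDistance : (n : ℕ) → Square n → ℕ → Set
InnerDistance n m d =
  (∀ i j i' j' → Adjacent i j i' j' → d ≤ dist n (m i j) (m i' j')) ×
  (∃[ i ] ∃[ j ] ∃[ i' ] ∃[ j' ]
     (Adjacent i j i' j' × dist n (m i j) (m i' j') ≡ d))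

csuc : {n : ℕ} → Fin n → Fin n
csuc {suc k} j with suc (toℕ j) <? suc k
... | yes p = fromℕ< p
... | no  _ = zero

-- extended difference row of a row s (of a Latin square of order n = 2k):
-- entry j (0-indexed) is  h_j - k  where h_j ∈ [0,n-1], h_j ≡ s_{j+1} - s_j,
-- and the last entry is h - k with h ≡ s_1 - s_n (cyclic successor).
extDiff : (n k : ℕ) → (Fin n → ℕ) → Fin n → ℤ
extDiff n k s j = (+ resid n (s (csuc j)) (s j)) - (+ k)

rowA : (n k : ℕ) → Fin n → ℤ
rowA n k j with suc (toℕ j) <? n
... | yes _ = + (toℕ j % 2)
... | no  _ = (+ 1) - (+ k)

-- row product: all rows of the horizontal difference matrix H are equal,
-- where h_{i,j} ∈ [0,n-1], h_{i,j} ≡ m_{i,j+1} - m_{i,j}  (j ≤ n-1)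
IsRowProduct : (n : ℕ) → Square n → Set
IsRowProduct n m =
  ∀ i i' j j' → toℕ j' ≡ suc (toℕ j) →
    resid n (m i j') (m i j) ≡ resid n (m i' j') (m i' j)

{-# OPTIONS --safe #-}
-- Work modulo n = 2k. An inner distance of k - 1 says that adjacent cells differ by k + δ with
-- δ ∈ {-1, 0, 1}, and Row A says that its row is R j = x + pos j, where pos lists the ranks
-- 0, k, 1, k + 1, 2, ... . Call a row aligned if it is R plus a constant. Next to an aligned row,
-- a row is R + const + e with offsets e j ∈ {-1, 0, 1}. If e misses -1 or +1, it is constant:
-- stepping through the row in the order of pos, a rise of e would repeat a symbol. If e takes
-- both values, the row beyond is R + const + E with E = e + e' ∈ {±1, ±2} changing sign; the
-- horizontal constraints then make E positive and then negative along the row, which leaves no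
-- column for one of two particular symbols. A first or last row has two aligned rows on one side,
-- whose common offset e must avoid. Once every row is aligned, all rows have the same differences.
module Submission where

open import Defs
open import Data.Nat using (ℕ; _≤_; _*_; _∸_)
open import Data.Fin using (Fin)
open import Data.Product using (∃-syntax)
open import Relation.Binary.PropositionalEquality using (_≡_)

open import Data.Bool using (T)
open import Data.Empty using (⊥; ⊥-elim)
open import Data.Integer as ℤ
  using (ℤ; +_; -[1+_]; 0ℤ; 1ℤ; -1ℤ; _+_; _-_; -_; ∣_∣; Negative)
import Data.Integer.Properties as ℤ
open import Data.Integer.DivMod using (_%ℕ_; _/ℕ_; a≡a%ℕn+[a/ℕn]*n; n%ℕd<d)
open import Data.Integer.Divisibility.Signed using (_∣_; divides; ∣m∣n⇒∣m+n; ∣m⇒∣-m; ∣⇒∣ᵤ)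
open import Data.Integer.Tactic.RingSolver using (solve-∀)
open import Data.Nat.Tactic.RingSolver using () renaming (solve-∀ to ℕ-solve-∀)
open import Data.Nat as ℕ using (suc; zero; _<_; s≤s; z≤n; NonZero)
import Data.Nat.Properties as ℕ
import Data.Nat.Divisibility as ℕᵈ
open import Data.Product using (Σ; _×_; _,_; proj₁; proj₂)
open import Data.Sum using (_⊎_; inj₁; inj₂; [_,_])
open import Relation.Binary using (Setoid)
open import Relation.Binary.PropositionalEquality
  using (_≢_; refl; sym; trans; cong; cong₂; subst; subst₂; module ≡-Reasoning)
open import Relation.Nullary using (¬_; yes; no)
open import Function using (_∘_; id)
import Data.Fin as Fin
import Data.Fin.Properties as Fin
import Relation.Binary.Reasoning.Setoid

data Offset : ℤ → Set where
  -1ₒ : Offset -1ℤ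
  0ₒ  : Offset 0ℤ
  +1ₒ : Offset 1ℤ

-‿offset : ∀ {δ} → Offset δ → Offset (- δ)
-‿offset -1ₒ = +1ₒ
-‿offset 0ₒ  = 0ₒ
-‿offset +1ₒ = -1ₒ

-- the nonzero values of a sum of two offsets
data Jolt : ℤ → Set where
  -2ⱼ : Jolt -[1+ 1 ]
  -1ⱼ : Jolt -1ℤ
  +1ⱼ : Jolt 1ℤ
  +2ⱼ : Jolt (+ 2)

jolt-of-nonzero : ∀ {a} → Offset a → a ≢ 0ℤ → Jolt a
jolt-of-nonzero -1ₒ _   = -1ⱼ
jolt-of-nonzero 0ₒ  a≢0 = ⊥-elim (a≢0 refl)
jolt-of-nonzero +1ₒ _   = +1ⱼ

jolt-of-sum : ∀ {a b} → Offset a → Offset b → a + b ≢ 0ℤ → Jolt (a + b)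
jolt-of-sum -1ₒ -1ₒ _     = -2ⱼ
jolt-of-sum -1ₒ 0ₒ  _     = -1ⱼ
jolt-of-sum -1ₒ +1ₒ sum≢0 = ⊥-elim (sum≢0 refl)
jolt-of-sum 0ₒ  -1ₒ _     = -1ⱼ
jolt-of-sum 0ₒ  0ₒ  sum≢0 = ⊥-elim (sum≢0 refl)
jolt-of-sum 0ₒ  +1ₒ _     = +1ⱼ
jolt-of-sum +1ₒ -1ₒ sum≢0 = ⊥-elim (sum≢0 refl)
jolt-of-sum +1ₒ 0ₒ  _     = +1ⱼ
jolt-of-sum +1ₒ +1ₒ _     = +2ⱼ

-1+offset-negative : ∀ {b} → Offset b → -1ℤ + b ≢ 0ℤ → Negative (-1ℤ + b)
-1+offset-negative -1ₒ _     = _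
-1+offset-negative 0ₒ  _     = _
-1+offset-negative +1ₒ sum≢0 = ⊥-elim (sum≢0 refl)

1+offset-nonnegative : ∀ {b} → Offset b → ¬ Negative (1ℤ + b)
1+offset-nonnegative -1ₒ ()
1+offset-nonnegative 0ₒ  ()
1+offset-nonnegative +1ₒ ()

offset-sum-minus-two : ∀ {a b} → Offset a → Offset b → a + b ≡ -[1+ 1 ] → a ≡ -1ℤ
offset-sum-minus-two -1ₒ _   _  = refl
offset-sum-minus-two 0ₒ  -1ₒ ()
offset-sum-minus-two 0ₒ  0ₒ  ()
offset-sum-minus-two 0ₒ  +1ₒ ()
offset-sum-minus-two +1ₒ -1ₒ ()
offset-sum-minus-two +1ₒ 0ₒ  ()
offset-sum-minus-two +1ₒ +1ₒ ()

offset-sum-two : ∀ {a b} → Offset a → Offset b → a + b ≡ + 2 → a ≡ 1ℤ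
offset-sum-two +1ₒ _   _  = refl
offset-sum-two -1ₒ -1ₒ ()
offset-sum-two -1ₒ 0ₒ  ()
offset-sum-two -1ₒ +1ₒ ()
offset-sum-two 0ₒ  -1ₒ ()
offset-sum-two 0ₒ  0ₒ  ()
offset-sum-two 0ₒ  +1ₒ ()

offset-≢-2 : ∀ {a} → Offset a → a ≢ -[1+ 1 ]
offset-≢-2 -1ₒ ()
offset-≢-2 0ₒ  ()
offset-≢-2 +1ₒ ()

offset-≢-1⇒≡0⊎≡1 : ∀ {a} → Offset a → a ≢ -1ℤ → a ≡ 0ℤ ⊎ a ≡ 0ℤ + 1ℤ
offset-≢-1⇒≡0⊎≡1 -1ₒ a≢-1 = ⊥-elim (a≢-1 refl)
offset-≢-1⇒≡0⊎≡1 0ₒ  _    = inj₁ refl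
offset-≢-1⇒≡0⊎≡1 +1ₒ _    = inj₂ refl

offset-≢1⇒≡-1⊎≡0 : ∀ {a} → Offset a → a ≢ 1ℤ → a ≡ -1ℤ ⊎ a ≡ -1ℤ + 1ℤ
offset-≢1⇒≡-1⊎≡0 -1ₒ _   = inj₁ refl
offset-≢1⇒≡-1⊎≡0 0ₒ  _   = inj₂ refl
offset-≢1⇒≡-1⊎≡0 +1ₒ a≢1 = ⊥-elim (a≢1 refl)

offset-≢±1⇒≡0 : ∀ {a} → Offset a → a ≢ -1ℤ → a ≢ 1ℤ → a ≡ 0ℤ
offset-≢±1⇒≡0 -1ₒ a≢-1 _   = ⊥-elim (a≢-1 refl)
offset-≢±1⇒≡0 0ₒ  _    _   = refl
offset-≢±1⇒≡0 +1ₒ _    a≢1 = ⊥-elim (a≢1 refl)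

module Congruence (n : ℕ) .{{_ : NonZero n}} where

  infix 4 _≋_
  record _≋_ (a b : ℤ) : Set where
    constructor ≋-intro
    field divides-difference : + n ∣ a - b

  ≋-reflexive : ∀ {a b} → a ≡ b → a ≋ b
  ≋-reflexive {a} refl = ≋-intro (divides 0ℤ (eq a))
    where eq : ∀ a → a - a ≡ 0ℤ
          eq = solve-∀

  ≋-refl : ∀ {a} → a ≋ a
  ≋-refl = ≋-reflexive refl

  ≋-sym : ∀ {a b} → a ≋ b → b ≋ a
  ≋-sym {a} {b} (≋-intro n∣a-b) = ≋-intro (subst (+ n ∣_) (eq a b) (∣m⇒∣-m n∣a-b))
    where eq : ∀ a b → - (a - b) ≡ b - a
          eq = solve-∀

  ≋-trans : ∀ {a b c} → a ≋ b → b ≋ c → a ≋ c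
  ≋-trans {a} {b} {c} (≋-intro p) (≋-intro q) = ≋-intro (subst (+ n ∣_) (eq a b c) (∣m∣n⇒∣m+n p q))
    where eq : ∀ a b c → (a - b) + (b - c) ≡ a - c
          eq = solve-∀

  ≋-setoid : Setoid _ _
  ≋-setoid = record
    { Carrier = ℤ ; _≈_ = _≋_
    ; isEquivalence = record { refl = ≋-refl ; sym = ≋-sym ; trans = ≋-trans } }

  +-cong : ∀ {a b c d} → a ≋ b → c ≋ d → a + c ≋ b + d
  +-cong {a} {b} {c} {d} (≋-intro p) (≋-intro q) = ≋-intro (subst (+ n ∣_) (eq a b c d) (∣m∣n⇒∣m+n p q))
    where eq : ∀ a b c d → (a - b) + (c - d) ≡ (a + c) - (b + d)
          eq = solve-∀

  +-congˡ : ∀ c {a b} → a ≋ b → c + a ≋ c + b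
  +-congˡ c = +-cong (≋-refl {c})

  +-congʳ : ∀ c {a b} → a ≋ b → a + c ≋ b + c
  +-congʳ c a≋b = +-cong a≋b (≋-refl {c})

  -‿cong : ∀ {a b} → a ≋ b → - a ≋ - b
  -‿cong {a} {b} (≋-intro p) = ≋-intro (subst (+ n ∣_) (eq a b) (∣m⇒∣-m p))
    where eq : ∀ a b → - (a - b) ≡ - a - - b
          eq = solve-∀

  +-cancelˡ-≋ : ∀ a {b c} → a + b ≋ a + c → b ≋ c
  +-cancelˡ-≋ a {b} {c} h = begin
    b               ≡⟨ cancel a b ⟨
    - a + (a + b)   ≈⟨ +-congˡ (- a) h ⟩
    - a + (a + c)   ≡⟨ cancel a c ⟩
    c               ∎
    where open Relation.Binary.Reasoning.Setoid ≋-setoid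
          cancel : ∀ a b → - a + (a + b) ≡ b
          cancel = solve-∀

  +-cancelʳ-≋ : ∀ {a b} c → a + c ≋ b + c → a ≋ b
  +-cancelʳ-≋ {a} {b} c h =
    +-cancelˡ-≋ c (≋-trans (≋-reflexive (ℤ.+-comm c a)) (≋-trans h (≋-reflexive (ℤ.+-comm b c))))

  ≋-flip : ∀ {a b δ} → b ≋ a + δ → a ≋ b + - δ
  ≋-flip {a} {b} {δ} h = begin
    a            ≡⟨ cancel a δ ⟨
    a + δ + - δ  ≈⟨ +-congʳ (- δ) (≋-sym h) ⟩
    b + - δ      ∎
    where open Relation.Binary.Reasoning.Setoid ≋-setoid
          cancel : ∀ a d → a + d + - d ≡ a
          cancel = solve-∀

  n≋0 : + n ≋ 0ℤ
  n≋0 = ≋-intro (divides 1ℤ (trans (ℤ.+-identityʳ (+ n)) (sym (ℤ.*-identityˡ (+ n)))))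

  small-multiple : ∀ {z} → ∣ z ∣ < n → + n ∣ z → z ≡ 0ℤ
  small-multiple {z} ∣z∣<n n∣z = ℤ.∣i∣≡0⇒i≡0 (vanish ∣ z ∣ ∣z∣<n (∣⇒∣ᵤ n∣z))
    where vanish : ∀ m → m < n → n ℕᵈ.∣ m → m ≡ 0
          vanish zero    _   _   = refl
          vanish (suc m) m<n n∣m = ⊥-elim (ℕᵈ.>⇒∤ m<n n∣m)

  ≋⇒≡ : ∀ {a b} → ∣ a - b ∣ < n → a ≋ b → a ≡ b
  ≋⇒≡ {a} {b} small (≋-intro n∣a-b) = ℤ.i-j≡0⇒i≡j a b (small-multiple small n∣a-b)

  +≋+⇒≡ : ∀ {a b} → a < n ℕ.+ b → b < n ℕ.+ a → + a ≋ + b → a ≡ b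
  +≋+⇒≡ {zero}  {zero}  _ _ _ = refl
  +≋+⇒≡ {zero}  {suc b} _ b<n (≋-intro n∣)
    with small-multiple (subst (suc b <_) (ℕ.+-identityʳ n) b<n) n∣
  ... | ()
  +≋+⇒≡ {suc a} {zero}  a<n _ (≋-intro n∣)
    with small-multiple {+ suc a} (subst (suc a <_) (ℕ.+-identityʳ n) a<n) (subst (+ n ∣_) (ℤ.+-identityʳ _) n∣)
  ... | ()
  +≋+⇒≡ {suc a} {suc b} p q (≋-intro n∣) = cong suc (+≋+⇒≡ (pred p) (pred q) (≋-intro (subst (+ n ∣_) eq n∣)))
    where eq : suc a ℤ.⊖ suc b ≡ + a - + b
          eq = trans (ℤ.[1+m]⊖[1+n]≡m⊖n a b) (sym (ℤ.m-n≡m⊖n a b))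
          pred : ∀ {a b} → suc a < n ℕ.+ suc b → a < n ℕ.+ b
          pred {a} {b} lt = ℕ.≤-pred (subst (suc (suc a) ≤_) (ℕ.+-suc n b) lt)

  %ℕ-≋ : ∀ x → + (x %ℕ n) ≋ x
  %ℕ-≋ x = ≋-intro (divides (- (x /ℕ n)) (begin
    + (x %ℕ n) - x                                ≡⟨ cong (λ x' → + (x %ℕ n) - x') (a≡a%ℕn+[a/ℕn]*n x n) ⟩
    + (x %ℕ n) - (+ (x %ℕ n) + (x /ℕ n) ℤ.* + n)  ≡⟨ eq (+ (x %ℕ n)) (x /ℕ n) (+ n) ⟩
    - (x /ℕ n) ℤ.* + n                            ∎))
    where open ≡-Reasoning
          eq : ∀ r q m → r - (r + q ℤ.* m) ≡ - q ℤ.* m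
          eq = solve-∀

  -- If q ↦ q + h q is injective modulo n and h only takes the values c and c + 1,
  -- then a value c + 1 at q forces c + 1 at q + 1, and cyclically at 0 after n - 1.
  module _ (h : ℕ → ℤ) (c : ℤ)
           (two-valued : ∀ q → q < n → h q ≡ c ⊎ h q ≡ c + 1ℤ)
           (injective : ∀ q q' → q < n → q' < n → + q + h q ≋ + q' + h q' → q ≡ q') where

    private
      pred[n]<n : ℕ.pred n < n
      pred[n]<n = subst (ℕ.pred n <_) (ℕ.suc-pred n) (ℕ.n<1+n _)

      carry : ∀ q → + q + (c + 1ℤ) ≡ + suc q + c
      carry q = trans (shuffle (+ q) c) (cong (_+ c) (sym (ℤ.pos-+ 1 q)))
        where shuffle : ∀ q c → q + (c + 1ℤ) ≡ (1ℤ + q) + c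
              shuffle = solve-∀

      rises : ∀ {q} → suc q < n → h q ≡ c + 1ℤ → h (suc q) ≡ c + 1ℤ
      rises {q} sq<n hq with two-valued (suc q) sq<n
      ... | inj₂ hsq = hsq
      ... | inj₁ hsq = ⊥-elim (ℕ.<-irrefl (injective q (suc q) (ℕ.<-trans (ℕ.n<1+n q) sq<n) sq<n
                         (≋-reflexive (begin
        + q + h q           ≡⟨ cong (_+_ (+ q)) hq ⟩
        + q + (c + 1ℤ)      ≡⟨ carry q ⟩
        + suc q + c         ≡⟨ cong (_+_ (+ suc q)) hsq ⟨
        + suc q + h (suc q) ∎))) (ℕ.n<1+n q))
        where open ≡-Reasoning

      persists : ∀ {q q'} → q ℕ.≤′ q' → q' < n → h q ≡ c + 1ℤ → h q' ≡ c + 1ℤ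
      persists ℕ.≤′-refl      _    hq = hq
      persists (ℕ.≤′-step le) q'<n hq = rises q'<n (persists le (ℕ.<-trans (ℕ.n<1+n _) q'<n) hq)

      c≢c+1 : c ≢ c + 1ℤ
      c≢c+1 c≡c+1 with trans (sym (ℤ.+-inverseʳ c)) (trans (cong (_- c) c≡c+1) (cancel c))
        where cancel : ∀ c → c + 1ℤ - c ≡ 1ℤ
              cancel = solve-∀
      ... | ()

      only-0-rises : h 0 ≡ c → ∀ {q} → q < n → h q ≡ c + 1ℤ → q ≡ 0
      only-0-rises h0 {q} q<n hq = ℕ.n≤0⇒n≡0 (subst (q ≤_) pred[n]≡0 (ℕ.<⇒≤pred q<n))
        where
        open Relation.Binary.Reasoning.Setoid ≋-setoid
        wraps : + ℕ.pred n + h (ℕ.pred n) ≋ + 0 + h 0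
        wraps = begin
          + ℕ.pred n + h (ℕ.pred n)  ≡⟨ cong (_+_ (+ ℕ.pred n)) (persists (ℕ.≤⇒≤′ (ℕ.<⇒≤pred q<n)) pred[n]<n hq) ⟩
          + ℕ.pred n + (c + 1ℤ)      ≡⟨ carry (ℕ.pred n) ⟩
          + suc (ℕ.pred n) + c       ≡⟨ cong (λ m → + m + c) (ℕ.suc-pred n) ⟩
          + n + c                    ≈⟨ +-congʳ c n≋0 ⟩
          0ℤ + c                     ≡⟨ cong (_+_ 0ℤ) h0 ⟨
          + 0 + h 0                  ∎
        pred[n]≡0 : ℕ.pred n ≡ 0
        pred[n]≡0 = injective (ℕ.pred n) 0 pred[n]<n (ℕ.>-nonZero⁻¹ n) wraps

    two-valued-shift-constant : ∀ q → q < n → h q ≡ h 0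
    two-valued-shift-constant q q<n with two-valued 0 (ℕ.>-nonZero⁻¹ n) | two-valued q q<n
    ... | inj₂ h0 | _       = trans (persists (ℕ.≤⇒≤′ z≤n) q<n h0) (sym h0)
    ... | inj₁ h0 | inj₁ hq = trans hq (sym h0)
    ... | inj₁ h0 | inj₂ hq =
      ⊥-elim (c≢c+1 (trans (sym h0) (subst (λ q → h q ≡ c + 1ℤ) (only-0-rises h0 q<n hq) hq)))

  %ℕ-cong : ∀ {a b} → a ≋ b → a %ℕ n ≡ b %ℕ n
  %ℕ-cong {a} {b} a≋b =
    +≋+⇒≡ (ℕ.<-≤-trans (n%ℕd<d a n) (ℕ.m≤m+n n _)) (ℕ.<-≤-trans (n%ℕd<d b n) (ℕ.m≤m+n n _))
          (≋-trans (%ℕ-≋ a) (≋-trans a≋b (≋-sym (%ℕ-≋ b))))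

  residues-sum : ∀ a b → 0 < (a - b) %ℕ n → (a - b) %ℕ n ℕ.+ (b - a) %ℕ n ≡ n
  residues-sum a b 0<r =
    +≋+⇒≡ (ℕ.+-mono-< (n%ℕd<d (a - b) n) (n%ℕd<d (b - a) n))
          (ℕ.m<m+n n (ℕ.<-≤-trans 0<r (ℕ.m≤m+n _ _)))
          (≋-trans (≋-reflexive (ℤ.pos-+ ((a - b) %ℕ n) ((b - a) %ℕ n)))
          (≋-trans (+-cong (%ℕ-≋ (a - b)) (%ℕ-≋ (b - a)))
          (≋-trans (≋-reflexive (cancel a b)) (≋-sym n≋0))))
    where cancel : ∀ a b → (a - b) + (b - a) ≡ 0ℤ
          cancel = solve-∀

  module _ (6≤n : 6 ≤ n) where

    ≉-near : ∀ {a b} → a ≋ b → {_ : T (∣ a - b ∣ ℕ.≤ᵇ 5)} → .{{_ : ℤ.NonZero (a - b)}} → ⊥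
    ≉-near {a} {b} a≋b {near} =
      ℕ.≢-nonZero⁻¹ ∣ a - b ∣
        (cong ∣_∣ (ℤ.i≡j⇒i-j≡0 (≋⇒≡ (ℕ.≤-<-trans (ℕ.≤ᵇ⇒≤ ∣ a - b ∣ 5 near) 6≤n) a≋b)))

    -- b ≋ a + δ (resp. b + 1 ≋ a + δ) is how the offset changes from column 2t to 2t + 1
    -- (resp. from 2t + 1 to 2t + 2) of a row R + const + E with adjacent entries k + δ apart.
    jolt-even-negative : ∀ {a b δ} → Jolt a → Jolt b → Offset δ → b ≋ a + δ → Negative a → Negative b
    jolt-even-negative _   -2ⱼ _   _ _  = _
    jolt-even-negative _   -1ⱼ _   _ _  = _
    jolt-even-negative +1ⱼ _   _   _ ()
    jolt-even-negative +2ⱼ _   _   _ ()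
    jolt-even-negative -2ⱼ +1ⱼ -1ₒ h _  = ⊥-elim (≉-near h)
    jolt-even-negative -2ⱼ +1ⱼ 0ₒ  h _  = ⊥-elim (≉-near h)
    jolt-even-negative -2ⱼ +1ⱼ +1ₒ h _  = ⊥-elim (≉-near h)
    jolt-even-negative -2ⱼ +2ⱼ -1ₒ h _  = ⊥-elim (≉-near h)
    jolt-even-negative -2ⱼ +2ⱼ 0ₒ  h _  = ⊥-elim (≉-near h)
    jolt-even-negative -2ⱼ +2ⱼ +1ₒ h _  = ⊥-elim (≉-near h)
    jolt-even-negative -1ⱼ +1ⱼ -1ₒ h _  = ⊥-elim (≉-near h)
    jolt-even-negative -1ⱼ +1ⱼ 0ₒ  h _  = ⊥-elim (≉-near h)
    jolt-even-negative -1ⱼ +1ⱼ +1ₒ h _  = ⊥-elim (≉-near h)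
    jolt-even-negative -1ⱼ +2ⱼ -1ₒ h _  = ⊥-elim (≉-near h)
    jolt-even-negative -1ⱼ +2ⱼ 0ₒ  h _  = ⊥-elim (≉-near h)
    jolt-even-negative -1ⱼ +2ⱼ +1ₒ h _  = ⊥-elim (≉-near h)

    -- The one pair not excluded by size alone is a jump from -2 to +2, which is 6 ≋ 0 when n = 6.
    jolt-odd-negative : ∀ {a b δ} → Jolt a → Jolt b → Offset δ → b + 1ℤ ≋ a + δ →
                        (a ≡ -[1+ 1 ] → b ≢ + 2) → Negative a → Negative b
    jolt-odd-negative _   -2ⱼ _   _ _    _  = _
    jolt-odd-negative _   -1ⱼ _   _ _    _  = _
    jolt-odd-negative +1ⱼ _   _   _ _    ()
    jolt-odd-negative +2ⱼ _   _   _ _    ()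
    jolt-odd-negative -2ⱼ +1ⱼ -1ₒ h _    _  = ⊥-elim (≉-near h)
    jolt-odd-negative -2ⱼ +1ⱼ 0ₒ  h _    _  = ⊥-elim (≉-near h)
    jolt-odd-negative -2ⱼ +1ⱼ +1ₒ h _    _  = ⊥-elim (≉-near h)
    jolt-odd-negative -2ⱼ +2ⱼ -1ₒ h jump _  = ⊥-elim (jump refl refl)
    jolt-odd-negative -2ⱼ +2ⱼ 0ₒ  h _    _  = ⊥-elim (≉-near h)
    jolt-odd-negative -2ⱼ +2ⱼ +1ₒ h _    _  = ⊥-elim (≉-near h)
    jolt-odd-negative -1ⱼ +1ⱼ -1ₒ h _    _  = ⊥-elim (≉-near h)
    jolt-odd-negative -1ⱼ +1ⱼ 0ₒ  h _    _  = ⊥-elim (≉-near h)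
    jolt-odd-negative -1ⱼ +1ⱼ +1ₒ h _    _  = ⊥-elim (≉-near h)
    jolt-odd-negative -1ⱼ +2ⱼ -1ₒ h _    _  = ⊥-elim (≉-near h)
    jolt-odd-negative -1ⱼ +2ⱼ 0ₒ  h _    _  = ⊥-elim (≉-near h)
    jolt-odd-negative -1ⱼ +2ⱼ +1ₒ h _    _  = ⊥-elim (≉-near h)

    jolt-odd-after-two : ∀ {b δ} → Jolt b → Offset δ → b + 1ℤ ≋ + 2 + δ → ¬ Negative b
    jolt-odd-after-two -2ⱼ -1ₒ h _ = ≉-near h
    jolt-odd-after-two -2ⱼ 0ₒ  h _ = ≉-near h
    jolt-odd-after-two -2ⱼ +1ₒ h _ = ≉-near h
    jolt-odd-after-two -1ⱼ -1ₒ h _ = ≉-near h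
    jolt-odd-after-two -1ⱼ 0ₒ  h _ = ≉-near h
    jolt-odd-after-two -1ⱼ +1ₒ h _ = ≉-near h

    jolt-odd-before-minus-two : ∀ {a δ} → Jolt a → Offset δ → -[1+ 1 ] + 1ℤ ≋ a + δ → Negative a
    jolt-odd-before-minus-two -2ⱼ _   _ = _
    jolt-odd-before-minus-two -1ⱼ _   _ = _
    jolt-odd-before-minus-two +1ⱼ -1ₒ h = ⊥-elim (≉-near h)
    jolt-odd-before-minus-two +1ⱼ 0ₒ  h = ⊥-elim (≉-near h)
    jolt-odd-before-minus-two +1ⱼ +1ₒ h = ⊥-elim (≉-near h)
    jolt-odd-before-minus-two +2ⱼ -1ₒ h = ⊥-elim (≉-near h)
    jolt-odd-before-minus-two +2ⱼ 0ₒ  h = ⊥-elim (≉-near h)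
    jolt-odd-before-minus-two +2ⱼ +1ₒ h = ⊥-elim (≉-near h)

    offset-odd-no-jump : ∀ {δ} → Offset δ → 1ℤ + 1ℤ ≋ -1ℤ + δ → ⊥
    offset-odd-no-jump -1ₒ h = ≉-near h
    offset-odd-no-jump 0ₒ  h = ≉-near h
    offset-odd-no-jump +1ₒ h = ≉-near h

module Interleaving (k' : ℕ) where

  k : ℕ
  k = 3 ℕ.+ k'

  n : ℕ
  n = 2 * k

  open Congruence n public

  n≡k+k : n ≡ k ℕ.+ k
  n≡k+k = cong (k ℕ.+_) (ℕ.+-identityʳ k)

  6≤n : 6 ≤ n
  6≤n = ℕ.*-monoʳ-≤ 2 (ℕ.m≤m+n 3 k')

  k+k≋0 : + k + + k ≋ 0ℤ
  k+k≋0 = ≋-trans (≋-reflexive (trans (sym (ℤ.pos-+ k k)) (cong +_ (sym n≡k+k)))) n≋0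

  ev od : ℕ → ℕ
  ev t = t ℕ.+ t
  od t = suc (ev t)

  ev-suc : ∀ t → ev (suc t) ≡ suc (od t)
  ev-suc t = cong suc (ℕ.+-suc t t)

  pos : ℕ → ℕ
  pos 0                 = 0
  pos 1                 = k
  pos (suc (suc j))     = suc (pos j)

  pos-ev : ∀ t → pos (ev t) ≡ t
  pos-ev zero    = refl
  pos-ev (suc t) = trans (cong pos (ev-suc t)) (cong suc (pos-ev t))

  pos-od : ∀ t → pos (od t) ≡ t ℕ.+ k
  pos-od zero    = refl
  pos-od (suc t) = trans (cong (pos ∘ suc) (ev-suc t)) (cong suc (pos-od t))

  data Column : ℕ → Set where
    even : ∀ t → t < k → Column (ev t)
    odd  : ∀ t → t < k → Column (od t)

  ev<n⇒<k : ∀ {t} → ev t < n → t < k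
  ev<n⇒<k {t} lt = ℕ.≰⇒> λ k≤t → ℕ.<⇒≱ lt (subst (_≤ ev t) (sym n≡k+k) (ℕ.+-mono-≤ k≤t k≤t))

  private
    halve : ∀ j → Σ ℕ λ t → j ≡ ev t ⊎ j ≡ od t
    halve zero = 0 , inj₁ refl
    halve (suc j) with halve j
    ... | t , inj₁ refl = t , inj₂ refl
    ... | t , inj₂ refl = suc t , inj₁ (sym (ev-suc t))

  column : ∀ {j} → j < n → Column j
  column {j} j<n with halve j
  ... | t , inj₁ refl = even t (ev<n⇒<k {t} j<n)
  ... | t , inj₂ refl = odd t (ev<n⇒<k {t} (ℕ.<-trans (ℕ.n<1+n _) j<n))

  k≤n : k ≤ n
  k≤n = subst (k ≤_) (sym n≡k+k) (ℕ.m≤m+n k k)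

  od<n : ∀ {t} → t < k → od t < n
  od<n {t} t<k = subst (suc (od t) ≤_) (sym n≡k+k) (subst (_≤ k ℕ.+ k) (ev-suc t) (ℕ.+-mono-≤ t<k t<k))

  ev<n : ∀ {t} → t < k → ev t < n
  ev<n t<k = ℕ.<-trans (ℕ.n<1+n _) (od<n t<k)

  pos<n : ∀ {j} → j < n → pos j < n
  pos<n j<n with column j<n
  ... | even t t<k = subst (_< n) (sym (pos-ev t)) (ℕ.<-≤-trans t<k k≤n)
  ... | odd  t t<k = subst (_< n) (sym (pos-od t)) (subst (t ℕ.+ k <_) (sym n≡k+k) (ℕ.+-monoˡ-< k t<k))

  pos-injective : ∀ {j j'} → j < n → j' < n → pos j ≡ pos j' → j ≡ j'
  pos-injective j<n j'<n eq with column j<n | column j'<n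
  ... | even t _ | even t' _ = cong ev (trans (sym (pos-ev t)) (trans eq (pos-ev t')))
  ... | odd t _  | odd t' _  = cong od (ℕ.+-cancelʳ-≡ k t t' (trans (sym (pos-od t)) (trans eq (pos-od t'))))
  ... | even t t<k | odd t' _ =
    ⊥-elim (ℕ.<⇒≱ t<k (subst (k ≤_) (trans (sym (pos-od t')) (trans (sym eq) (pos-ev t))) (ℕ.m≤n+m k t')))
  ... | odd t _ | even t' t'<k =
    ⊥-elim (ℕ.<⇒≱ t'<k (subst (k ≤_) (trans (sym (pos-od t)) (trans eq (pos-ev t'))) (ℕ.m≤n+m k t)))

  idx : ℕ → ℕ
  idx q with q ℕ.<? k
  ... | yes _ = ev q
  ... | no  _ = od (q ∸ k)

  idx<n : ∀ {q} → q < n → idx q < n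
  idx<n {q} q<n with q ℕ.<? k
  ... | yes q<k = ev<n q<k
  ... | no  _   = od<n (ℕ.m<n+o⇒m∸n<o q k (subst (q <_) n≡k+k q<n))

  pos-idx : ∀ q → pos (idx q) ≡ q
  pos-idx q with q ℕ.<? k
  ... | yes _   = pos-ev q
  ... | no  q≮k = trans (pos-od (q ∸ k)) (ℕ.m∸n+n≡m (ℕ.≮⇒≥ q≮k))

  idx-pos : ∀ {j} → j < n → idx (pos j) ≡ j
  idx-pos j<n = pos-injective (idx<n (pos<n j<n)) j<n (pos-idx _)

  pos-od-antipode : ∀ t c → t ℕ.+ c ≡ k → + pos (od t) + + c ≋ 0ℤ
  pos-od-antipode t c t+c≡k = ≋-trans (≋-reflexive (trans (sym (ℤ.pos-+ (pos (od t)) c)) (cong +_ sum≡n))) n≋0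
    where sum≡n : pos (od t) ℕ.+ c ≡ n
          sum≡n = trans (cong (ℕ._+ c) (pos-od t))
                  (trans (shuffle t k c) (trans (cong (ℕ._+ k) t+c≡k) (sym n≡k+k)))
            where shuffle : ∀ t k c → t ℕ.+ k ℕ.+ c ≡ t ℕ.+ c ℕ.+ k
                  shuffle = ℕ-solve-∀

  locate : ∀ {j J} c → j < n → J < n → + pos j + c ≋ 0ℤ → + pos J + c ≋ 0ℤ → j ≡ J
  locate c j<n J<n hj hJ = pos-injective j<n J<n
    (+≋+⇒≡ (ℕ.<-≤-trans (pos<n j<n) (ℕ.m≤m+n n _)) (ℕ.<-≤-trans (pos<n J<n) (ℕ.m≤m+n n _))
         (+-cancelʳ-≋ c (≋-trans hj (≋-sym hJ))))

  record Shifted (X : ℕ → ℤ) (y : ℤ) (F : ℕ → ℤ) : Set where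
    constructor shifted-by
    field entry : ∀ j → j < n → X j ≋ y + + pos j + F j
  open Shifted public

  private
    open module ≋-Reasoning = Relation.Binary.Reasoning.Setoid ≋-setoid

  NearAntipodal : ℤ → ℤ → Set
  NearAntipodal a b = Σ ℤ λ δ → Offset δ × b ≋ a + + k + δ

  near-antipodal-sym : ∀ {a b} → NearAntipodal a b → NearAntipodal b a
  near-antipodal-sym {a} {b} (δ , offset , b≋) = - δ , -‿offset offset , (begin
    a                                  ≈⟨ ≋-flip (≋-trans b≋ (≋-reflexive (ℤ.+-assoc a (+ k) δ))) ⟩
    b + - (+ k + δ)                    ≡⟨ ℤ.+-identityʳ _ ⟨
    b + - (+ k + δ) + 0ℤ               ≈⟨ +-congˡ (b + - (+ k + δ)) k+k≋0 ⟨
    b + - (+ k + δ) + (+ k + + k)      ≡⟨ regroup b (+ k) δ ⟩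
    b + + k + - δ                      ∎)
    where regroup : ∀ b k d → b + - (k + d) + (k + k) ≡ b + k + - d
          regroup = solve-∀

  near-antipodal-of-dist : ∀ a b → suc (suc k') ≤ dist n a b → NearAntipodal (+ a) (+ b)
  near-antipodal-of-dist a b far =
    let δ , offset , r₂≡k+δ = window (r₂ ∸ suc (suc k')) d≤2 in δ , offset , (begin
      + b                          ≡⟨ split (+ a) (+ b) ⟩
      + a + (+ b - + a)            ≈⟨ +-congˡ (+ a) (%ℕ-≋ (+ b - + a)) ⟨
      + a + + r₂                   ≡⟨ cong (λ r → + a + + r) (ℕ.m∸n+n≡m far₂) ⟨
      + a + + (r₂ ∸ suc (suc k') ℕ.+ suc (suc k'))  ≡⟨ cong (_+_ (+ a)) r₂≡k+δ ⟩
      + a + (+ k + δ)              ≡⟨ ℤ.+-assoc (+ a) (+ k) δ ⟨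
      + a + + k + δ                ∎)
    where
    r₁ r₂ : ℕ
    r₁ = (+ a - + b) %ℕ n
    r₂ = (+ b - + a) %ℕ n
    far₁ : suc (suc k') ≤ r₁
    far₁ = ℕ.m≤n⊓o⇒m≤n r₁ r₂ far
    far₂ : suc (suc k') ≤ r₂
    far₂ = ℕ.m≤n⊓o⇒m≤o r₁ r₂ far
    split : ∀ a b → b ≡ a + (b - a)
    split = solve-∀
    r₁+r₂≡n : r₁ ℕ.+ r₂ ≡ n
    r₁+r₂≡n = residues-sum (+ a) (+ b) (ℕ.<-≤-trans (s≤s z≤n) far₁)
    r₂≤k+1 : r₂ ≤ suc k
    r₂≤k+1 = ℕ.+-cancelˡ-≤ (suc (suc k')) r₂ (suc k)
               (ℕ.≤-trans (ℕ.+-monoˡ-≤ r₂ far₁) (ℕ.≤-reflexive (trans r₁+r₂≡n (n≡ k'))))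
      where n≡ : ∀ m → 2 * (3 ℕ.+ m) ≡ suc (suc m) ℕ.+ suc (3 ℕ.+ m)
            n≡ = ℕ-solve-∀
    d≤2 : r₂ ∸ suc (suc k') ≤ 2
    d≤2 = ℕ.≤-trans (ℕ.∸-monoˡ-≤ (suc (suc k')) r₂≤k+1) (ℕ.≤-reflexive (ℕ.m+n∸n≡m 2 (suc (suc k'))))
    window : ∀ d → d ≤ 2 → Σ ℤ λ δ → Offset δ × + (d ℕ.+ suc (suc k')) ≡ + k + δ
    window 0 _ = -1ℤ , -1ₒ , refl
    window 1 _ = 0ℤ , 0ₒ , sym (ℤ.+-identityʳ (+ k))
    window 2 _ = 1ℤ , +1ₒ , cong +_ (ℕ.+-comm 1 k)
    window (suc (suc (suc _))) (s≤s (s≤s ()))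

  RowAntipodal : (ℕ → ℤ) → Set
  RowAntipodal X = ∀ j → suc j < n → NearAntipodal (X j) (X (suc j))

  ColumnAntipodal : (ℕ → ℤ) → (ℕ → ℤ) → Set
  ColumnAntipodal X X' = ∀ j → NearAntipodal (X j) (X' j)

  InjectiveOn : (ℕ → ℤ) → Set
  InjectiveOn X = ∀ {j j'} → j < n → j' < n → X j ≋ X j' → j ≡ j'

  SurjectiveOn : (ℕ → ℤ) → Set
  SurjectiveOn X = ∀ z → Σ ℕ λ j → j < n × X j ≋ z

  Aligned : (ℕ → ℤ) → Set
  Aligned X = Σ ℤ λ y → Shifted X y (λ _ → 0ℤ)

  private
    parity-sum : ∀ j → + (j ℕ.% 2) + + (suc j ℕ.% 2) ≡ 1ℤ
    parity-sum 0             = refl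
    parity-sum 1             = refl
    parity-sum (suc (suc j)) = parity-sum j

  alternating-shifted : ∀ {R} → (∀ j → suc j < n → R (suc j) ≋ R j + + k + + (j ℕ.% 2)) →
                        Shifted R (R 0) (λ _ → 0ℤ)
  alternating-shifted {R} step = shifted-by go
    where
    go : ∀ j → j < n → R j ≋ R 0 + + pos j + 0ℤ
    go 0             _     = ≋-reflexive (sym (trans (ℤ.+-identityʳ _) (ℤ.+-identityʳ _)))
    go 1             1<n   = step 0 1<n
    go (suc (suc j)) ssj<n = begin
      R (suc (suc j))                  ≈⟨ step (suc j) ssj<n ⟩
      R (suc j) + + k + p'             ≈⟨ +-congʳ _ (+-congʳ _ (step j sj<n)) ⟩
      R j + + k + p + + k + p'         ≡⟨ regroup (R j) (+ k) p p' ⟩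
      R j + (p + p') + (+ k + + k)     ≈⟨ +-congˡ (R j + (p + p')) k+k≋0 ⟩
      R j + (p + p') + 0ℤ              ≡⟨ cong (λ m → R j + m + 0ℤ) (parity-sum j) ⟩
      R j + 1ℤ + 0ℤ                    ≈⟨ +-congʳ _ (+-congʳ _ (go j (ℕ.<-trans (ℕ.n<1+n j) sj<n))) ⟩
      R 0 + + pos j + 0ℤ + 1ℤ + 0ℤ     ≡⟨ carry (R 0) (+ pos j) ⟩
      R 0 + (1ℤ + + pos j) + 0ℤ        ∎
      where
      sj<n = ℕ.<-trans (ℕ.n<1+n _) ssj<n
      p p' : ℤ
      p  = + (j ℕ.% 2)
      p' = + (suc j ℕ.% 2)
      regroup : ∀ r k a b → r + k + a + k + b ≡ r + (a + b) + (k + k)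
      regroup = solve-∀
      carry : ∀ r p → r + p + 0ℤ + 1ℤ + 0ℤ ≡ r + (1ℤ + p) + 0ℤ
      carry = solve-∀

  module _ {X : ℕ → ℤ} {y : ℤ} {F : ℕ → ℤ} (shifted : Shifted X y F) where

    shifted-ev : ∀ {t} → t < k → X (ev t) ≋ y + + t + F (ev t)
    shifted-ev {t} t<k =
      ≋-trans (entry shifted (ev t) (ev<n t<k)) (≋-reflexive (cong (λ p → y + + p + F (ev t)) (pos-ev t)))

    shifted-od : ∀ {t} → t < k → X (od t) ≋ y + + t + + k + F (od t)
    shifted-od {t} t<k = begin
      X (od t)                     ≈⟨ entry shifted (od t) (od<n t<k) ⟩
      y + + pos (od t) + F (od t)  ≡⟨ cong (λ p → y + + p + F (od t)) (pos-od t) ⟩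
      y + + (t ℕ.+ k) + F (od t)   ≡⟨ cong (λ p → y + p + F (od t)) (ℤ.pos-+ t k) ⟩
      y + (+ t + + k) + F (od t)   ≡⟨ cong (_+ F (od t)) (ℤ.+-assoc y (+ t) (+ k)) ⟨
      y + + t + + k + F (od t)     ∎

    module _ (antipodal : RowAntipodal X) where

      even-step : ∀ {t} → t < k → Σ ℤ λ δ → Offset δ × F (od t) ≋ F (ev t) + δ
      even-step {t} t<k with antipodal (ev t) (od<n t<k)
      ... | δ , offset , step = δ , offset , +-cancelˡ-≋ (y + + t + + k) (begin
        y + + t + + k + F (od t)         ≈⟨ shifted-od t<k ⟨
        X (od t)                         ≈⟨ step ⟩
        X (ev t) + + k + δ               ≈⟨ +-congʳ _ (+-congʳ _ (shifted-ev t<k)) ⟩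
        y + + t + F (ev t) + + k + δ     ≡⟨ swap y (+ t) (F (ev t)) (+ k) δ ⟩
        y + + t + + k + (F (ev t) + δ)   ∎)
        where swap : ∀ y t f k d → y + t + f + k + d ≡ y + t + k + (f + d)
              swap = solve-∀

      odd-step : ∀ {t} → suc t < k → Σ ℤ λ δ → Offset δ × F (ev (suc t)) + 1ℤ ≋ F (od t) + δ
      odd-step {t} st<k with antipodal (od t) (subst (_< n) (ev-suc t) (ev<n st<k))
      ... | δ , offset , step = δ , offset , +-cancelˡ-≋ (y + + t) (begin
        y + + t + (F (ev (suc t)) + 1ℤ)          ≡⟨ carry y (+ t) (F (ev (suc t))) ⟩
        y + + suc t + F (ev (suc t))             ≈⟨ shifted-ev st<k ⟨
        X (ev (suc t))                           ≡⟨ cong X (ev-suc t) ⟩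
        X (suc (od t))                           ≈⟨ step ⟩
        X (od t) + + k + δ                       ≈⟨ +-congʳ _ (+-congʳ _ (shifted-od (ℕ.<-trans (ℕ.n<1+n t) st<k))) ⟩
        y + + t + + k + F (od t) + + k + δ       ≡⟨ regroup y (+ t) (+ k) (F (od t)) δ ⟩
        y + + t + (F (od t) + δ) + (+ k + + k)   ≈⟨ +-congˡ (y + + t + (F (od t) + δ)) k+k≋0 ⟩
        y + + t + (F (od t) + δ) + 0ℤ            ≡⟨ ℤ.+-identityʳ _ ⟩
        y + + t + (F (od t) + δ)                 ∎)
        where carry : ∀ y t f → y + t + (f + 1ℤ) ≡ y + (1ℤ + t) + f
              carry = solve-∀
              regroup : ∀ y t k f d → y + t + k + f + k + d ≡ y + t + (f + d) + (k + k)
              regroup = solve-∀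

  translate : ∀ {X X' y F} → Shifted X y F → (v : ColumnAntipodal X X') →
              Shifted X' (y + + k) (λ j → F j + proj₁ (v j))
  translate {X} {X'} {y} {F} shifted v = shifted-by λ j j<n →
    let δ , _ , step = v j in begin
      X' j                        ≈⟨ step ⟩
      X j + + k + δ               ≈⟨ +-congʳ _ (+-congʳ _ (entry shifted j j<n)) ⟩
      y + + pos j + F j + + k + δ ≡⟨ swap y (+ pos j) (F j) (+ k) δ ⟩
      y + + k + + pos j + (F j + δ) ∎
    where swap : ∀ y p f k d → y + p + f + k + d ≡ y + k + p + (f + d)
          swap = solve-∀

  rebase : ∀ {X y F} c G → (∀ j → j < n → F j ≡ c + G j) → Shifted X y F → Shifted X (y + c) G
  rebase {X} {y} {F} c G F≡c+G shifted = shifted-by λ j j<n → begin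
    X j                     ≈⟨ entry shifted j j<n ⟩
    y + + pos j + F j       ≡⟨ cong (_+_ (y + + pos j)) (F≡c+G j j<n) ⟩
    y + + pos j + (c + G j) ≡⟨ swap y (+ pos j) c (G j) ⟩
    y + c + + pos j + G j   ∎
    where swap : ∀ y p c g → y + p + (c + g) ≡ y + c + p + g
          swap = solve-∀

  antipodal-twice : ∀ {a b c δ δ'} → b ≋ a + + k + δ → c ≋ b + + k + δ' → c ≋ a + (δ + δ')
  antipodal-twice {a} {b} {c} {δ} {δ'} b≋ c≋ = begin
    c                                  ≈⟨ c≋ ⟩
    b + + k + δ'                       ≈⟨ +-congʳ _ (+-congʳ _ b≋) ⟩
    a + + k + δ + + k + δ'             ≡⟨ regroup a (+ k) δ δ' ⟩
    a + (δ + δ') + (+ k + + k)         ≈⟨ +-congˡ (a + (δ + δ')) k+k≋0 ⟩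
    a + (δ + δ') + 0ℤ                  ≡⟨ ℤ.+-identityʳ _ ⟩
    a + (δ + δ')                       ∎
    where regroup : ∀ a k d d' → a + k + d + k + d' ≡ a + (d + d') + (k + k)
          regroup = solve-∀

  aligned-difference : ∀ {X X₂ y y₂} → Shifted X y (λ _ → 0ℤ) → Shifted X₂ y₂ (λ _ → 0ℤ) →
                       ∀ j → j < n → X₂ j ≋ X j + (y₂ - y)
  aligned-difference {X} {X₂} {y} {y₂} shifted shifted₂ j j<n = begin
    X₂ j                           ≈⟨ entry shifted₂ j j<n ⟩
    y₂ + + pos j + 0ℤ              ≡⟨ swap y y₂ (+ pos j) ⟩
    y + + pos j + 0ℤ + (y₂ - y)    ≈⟨ +-congʳ _ (entry shifted j j<n) ⟨
    X j + (y₂ - y)                 ∎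
    where swap : ∀ y y₂ p → y₂ + p + 0ℤ ≡ y + p + 0ℤ + (y₂ - y)
          swap = solve-∀

  shifted-difference : ∀ {X y} → Shifted X y (λ _ → 0ℤ) → ∀ {j j'} → j < n → j' < n →
                       X j' - X j ≋ + pos j' - + pos j
  shifted-difference {X} {y} shifted {j} {j'} j<n j'<n = begin
    X j' - X j                                 ≈⟨ +-cong (entry shifted j' j'<n) (-‿cong (entry shifted j j<n)) ⟩
    (y + + pos j' + 0ℤ) - (y + + pos j + 0ℤ)   ≡⟨ cancel y (+ pos j') (+ pos j) ⟩
    + pos j' - + pos j                         ∎
    where cancel : ∀ y p' p → (y + p' + 0ℤ) - (y + p + 0ℤ) ≡ p' - p
          cancel = solve-∀

  two-valued-row-constant : ∀ {X y e} → InjectiveOn X → Shifted X y e → (c : ℤ) →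
    (∀ j → j < n → e j ≡ c ⊎ e j ≡ c + 1ℤ) → ∀ j → j < n → e j ≡ e 0
  two-valued-row-constant {X} {y} {e} injective shifted c two-valued j j<n =
    trans (cong e (sym (idx-pos j<n)))
          (trans (constant (pos j) (pos<n j<n)) (cong e (idx-pos {0} (ℕ.<-≤-trans (s≤s z≤n) 6≤n))))
    where
    at-idx : ∀ {q} → q < n → X (idx q) ≋ y + (+ q + e (idx q))
    at-idx {q} q<n = begin
      X (idx q)                        ≈⟨ entry shifted (idx q) (idx<n q<n) ⟩
      y + + pos (idx q) + e (idx q)    ≡⟨ cong (λ p → y + + p + e (idx q)) (pos-idx q) ⟩
      y + + q + e (idx q)              ≡⟨ ℤ.+-assoc y (+ q) (e (idx q)) ⟩
      y + (+ q + e (idx q))            ∎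
    constant : ∀ q → q < n → e (idx q) ≡ e (idx 0)
    constant = two-valued-shift-constant (e ∘ idx) c (λ q q<n → two-valued (idx q) (idx<n q<n))
      λ q q' q<n q'<n h → trans (sym (pos-idx q)) (trans (cong pos (injective (idx<n q<n) (idx<n q'<n)
        (≋-trans (at-idx q<n) (≋-trans (+-congˡ y h) (≋-sym (at-idx q'<n)))))) (pos-idx q'))

  aligned-of-two-valued : ∀ {X y e} → InjectiveOn X → Shifted X y e → (c : ℤ) →
                          (∀ j → j < n → e j ≡ c ⊎ e j ≡ c + 1ℤ) → Aligned X
  aligned-of-two-valued {e = e} injective shifted c two-valued =
    _ , rebase (e 0) (λ _ → 0ℤ)
      (λ j j<n → trans (two-valued-row-constant injective shifted c two-valued j j<n) (sym (ℤ.+-identityʳ (e 0))))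
      shifted

  TakesBothSigns : (ℕ → ℤ) → Set
  TakesBothSigns e = (Σ ℕ λ j → j < n × e j ≡ -1ℤ) × (Σ ℕ λ j → j < n × e j ≡ 1ℤ)

  aligned-or-both-signs : ∀ {X y e} → InjectiveOn X → Shifted X y e → (∀ j → Offset (e j)) →
                          Aligned X ⊎ TakesBothSigns e
  aligned-or-both-signs {e = e} injective shifted offset
    with ℕ.anyUpTo? (λ j → e j ℤ.≟ -1ℤ) n | ℕ.anyUpTo? (λ j → e j ℤ.≟ 1ℤ) n
  ... | no ∄₋  | _      = inj₁ (aligned-of-two-valued injective shifted 0ℤ
                                  λ j j<n → offset-≢-1⇒≡0⊎≡1 (offset j) λ e≡ → ∄₋ (j , j<n , e≡))
  ... | yes _  | no ∄₊  = inj₁ (aligned-of-two-valued injective shifted -1ℤ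
                                  λ j j<n → offset-≢1⇒≡-1⊎≡0 (offset j) λ e≡ → ∄₊ (j , j<n , e≡))
  ... | yes ∃₋ | yes ∃₊ = inj₂ (∃₋ , ∃₊)

  -- Along the row a negative E stays negative, so E > 0 on an initial segment and E < 0 after it;
  -- then the columns where the symbols y and y - 1 could sit are all excluded.
  module _ {X : ℕ → ℤ} {y : ℤ} {E : ℕ → ℤ}
           (surjective : SurjectiveOn X) (antipodal : RowAntipodal X) (shifted : Shifted X y E)
           (jolt : ∀ j → j < n → Jolt (E j))
           (no-jump : ∀ {t} → suc t < k → E (od t) ≡ -[1+ 1 ] → E (ev (suc t)) ≢ + 2) where

    private
      even-forward : ∀ {t} → t < k → Negative (E (ev t)) → Negative (E (od t))
      even-forward t<k =
        let _ , offset , step = even-step shifted antipodal t<k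
        in jolt-even-negative 6≤n (jolt _ (ev<n t<k)) (jolt _ (od<n t<k)) offset step

      even-backward : ∀ {t} → t < k → Negative (E (od t)) → Negative (E (ev t))
      even-backward t<k =
        let _ , offset , step = even-step shifted antipodal t<k
        in jolt-even-negative 6≤n (jolt _ (od<n t<k)) (jolt _ (ev<n t<k)) (-‿offset offset) (≋-flip step)

      odd-forward : ∀ {t} → suc t < k → Negative (E (od t)) → Negative (E (ev (suc t)))
      odd-forward {t} st<k =
        let _ , offset , step = odd-step shifted antipodal st<k
        in jolt-odd-negative 6≤n (jolt _ (od<n (ℕ.<-trans (ℕ.n<1+n t) st<k))) (jolt _ (ev<n st<k))
                             offset step (no-jump st<k)

      odd-after-two : ∀ {t} → suc t < k → E (od t) ≡ + 2 → ¬ Negative (E (ev (suc t)))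
      odd-after-two {t} st<k E≡2 =
        let δ , offset , step = odd-step shifted antipodal st<k
        in jolt-odd-after-two 6≤n (jolt _ (ev<n st<k)) offset
                              (subst (λ a → E (ev (suc t)) + 1ℤ ≋ a + δ) E≡2 step)

      odd-before-minus-two : ∀ {t} → suc t < k → E (ev (suc t)) ≡ -[1+ 1 ] → Negative (E (od t))
      odd-before-minus-two {t} st<k E≡-2 =
        let δ , offset , step = odd-step shifted antipodal st<k
        in jolt-odd-before-minus-two 6≤n (jolt _ (od<n (ℕ.<-trans (ℕ.n<1+n t) st<k)))
                                     offset (subst (λ b → b + 1ℤ ≋ E (od t) + δ) E≡-2 step)

      negative-step : ∀ {j} → suc j < n → Negative (E j) → Negative (E (suc j))
      negative-step sj<n with column (ℕ.<-trans (ℕ.n<1+n _) sj<n)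
      ... | even t t<k = even-forward t<k
      ... | odd  t t<k =
        subst (Negative ∘ E) (ev-suc t) ∘ odd-forward (ev<n⇒<k (subst (_< n) (sym (ev-suc t)) sj<n))

      negative-onwards : ∀ {j j'} → j ℕ.≤′ j' → j' < n → Negative (E j) → Negative (E j')
      negative-onwards ℕ.≤′-refl      _    = λ neg → neg
      negative-onwards (ℕ.≤′-step le) j'<n =
        negative-step j'<n ∘ negative-onwards le (ℕ.<-trans (ℕ.n<1+n _) j'<n)

      landing : ∀ m → Σ ℕ λ j → j < n × + pos j + (E j + + m) ≋ 0ℤ
      landing m =
        let j , j<n , Xj≋ = surjective (y - + m)
        in j , j<n , (begin
          + pos j + (E j + + m)             ≡⟨ rearrange y (+ pos j) (E j) (+ m) ⟩
          (y + + pos j + E j) - (y - + m)   ≈⟨ +-cong (≋-sym (entry shifted j j<n)) (-‿cong (≋-sym Xj≋)) ⟩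
          X j - X j                         ≡⟨ ℤ.+-inverseʳ (X j) ⟩
          0ℤ                                ∎)
        where rearrange : ∀ y p e m → p + (e + m) ≡ (y + p + e) - (y - m)
              rearrange = solve-∀

      relocate : ∀ {j J a} c → j < n → J < n → E j ≡ a →
                 + pos j + c ≋ 0ℤ → + pos J + c ≋ 0ℤ → E J ≡ a
      relocate c j<n J<n Ej≡a hj hJ = trans (cong E (sym (locate c j<n J<n hj hJ))) Ej≡a

      ¬-1<0 : ¬ Negative 1ℤ
      ¬-1<0 ()

      0<k : 0 < k
      0<k = s≤s z≤n

      1<k : 1 < k
      1<k = s≤s (s≤s z≤n)

      2<k : 2 < k
      2<k = s≤s (s≤s (s≤s z≤n))

      k-3<k : k' < k
      k-3<k = ℕ.m≤n+m (suc k') 2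

      k-2<k : suc k' < k
      k-2<k = ℕ.m≤n+m (suc (suc k')) 1

      k-1<k : suc (suc k') < k
      k-1<k = ℕ.≤-refl

      last : ℕ
      last = od (suc (suc k'))

      n≡1+last : n ≡ suc last
      n≡1+last = trans n≡k+k (ev-suc (suc (suc k')))

      antipode₁ : + pos last + 1ℤ ≋ 0ℤ
      antipode₁ = pos-od-antipode (suc (suc k')) 1 (ℕ.+-comm (suc (suc k')) 1)

      antipode₂ : + pos (od (suc k')) + + 2 ≋ 0ℤ
      antipode₂ = pos-od-antipode (suc k') 2 (ℕ.+-comm (suc k') 2)

      antipode₃ : + pos (od k') + + 3 ≋ 0ℤ
      antipode₃ = pos-od-antipode k' 3 (ℕ.+-comm k' 3)

    no-sign-change : (Σ ℕ λ j → j < n × Negative (E j)) → (Σ ℕ λ j → j < n × ¬ Negative (E j)) → ⊥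
    no-sign-change (j₋ , j₋<n , negative) (j₊ , j₊<n , nonnegative) =
      let j , j<n , lands = landing 1 in symbol-below j<n (jolt j j<n) refl lands
      where
      last-negative : Negative (E last)
      last-negative =
        negative-onwards (ℕ.≤⇒≤′ (ℕ.≤-pred (subst (j₋ <_) n≡1+last j₋<n))) (od<n k-1<k) negative

      first-nonnegative : ¬ Negative (E 0)
      first-nonnegative neg = nonnegative (negative-onwards (ℕ.≤⇒≤′ z≤n) j₊<n neg)

      second-nonnegative : ¬ Negative (E 1)
      second-nonnegative = first-nonnegative ∘ even-backward 0<k

      penultimate-negative : Negative (E (ev (suc (suc k'))))
      penultimate-negative = even-backward k-1<k last-negative

      symbol-y : ∀ {j a} → j < n → Jolt a → E j ≡ a → + pos j + (a + + 0) ≋ 0ℤ → Negative (E 2)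
      symbol-y j<n -2ⱼ E≡a lands =
        even-backward 1<k (odd-before-minus-two 2<k (relocate -[1+ 1 ] j<n (ev<n 2<k) E≡a lands ≋-refl))
      symbol-y j<n -1ⱼ E≡a lands =
        subst Negative (sym (relocate -1ℤ j<n (ev<n 1<k) E≡a lands ≋-refl)) _
      symbol-y j<n +1ⱼ E≡a lands =
        ⊥-elim (¬-1<0 (subst Negative (relocate 1ℤ j<n (od<n k-1<k) E≡a lands antipode₁) last-negative))
      symbol-y j<n +2ⱼ E≡a lands =
        ⊥-elim (odd-after-two k-1<k (relocate (+ 2) j<n (od<n k-2<k) E≡a lands antipode₂) penultimate-negative)

      third-negative : Negative (E 2)
      third-negative = let j , j<n , lands = landing 0 in symbol-y j<n (jolt j j<n) refl lands

      symbol-below : ∀ {j a} → j < n → Jolt a → E j ≡ a → + pos j + (a + + 1) ≋ 0ℤ → ⊥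
      symbol-below j<n -2ⱼ E≡a lands =
        second-nonnegative (odd-before-minus-two 1<k (relocate -1ℤ j<n (ev<n 1<k) E≡a lands ≋-refl))
      symbol-below j<n -1ⱼ E≡a lands =
        first-nonnegative (subst Negative (sym (relocate 0ℤ j<n (ev<n 0<k) E≡a lands ≋-refl)) _)
      symbol-below j<n +1ⱼ E≡a lands =
        ¬-1<0 (subst Negative (relocate (+ 2) j<n (od<n k-2<k) E≡a lands antipode₂)
                              (negative-onwards (ℕ.≤⇒≤′ (s≤s (s≤s z≤n))) (od<n k-2<k) third-negative))
      symbol-below j<n +2ⱼ E≡a lands =
        odd-after-two k-2<k (relocate (+ 3) j<n (od<n k-3<k) E≡a lands antipode₃)
          (negative-onwards (ℕ.≤⇒≤′ (ℕ.+-mono-≤ (s≤s z≤n) (s≤s z≤n))) (ev<n k-2<k) third-negative)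

  middle-row-aligned : ∀ {X X' X'' y} → Shifted X y (λ _ → 0ℤ) →
    ColumnAntipodal X X' → ColumnAntipodal X' X'' → (∀ j → j < n → ¬ X'' j ≋ X j) →
    InjectiveOn X' → RowAntipodal X' → SurjectiveOn X'' → RowAntipodal X'' → Aligned X'
  middle-row-aligned {X} {X'} {X''} shifted v v' apart injective' antipodal' surjective'' antipodal'' =
    [ id , ⊥-elim ∘ sign-change ] (aligned-or-both-signs injective' shifted' offset)
    where
    e e' : ℕ → ℤ
    e  j = proj₁ (v j)
    e' j = proj₁ (v' j)
    offset : ∀ j → Offset (e j)
    offset j = proj₁ (proj₂ (v j))
    offset' : ∀ j → Offset (e' j)
    offset' j = proj₁ (proj₂ (v' j))
    shifted' : Shifted X' _ e
    shifted' = rebase 0ℤ e (λ _ _ → refl) (translate shifted v)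
    shifted'' : Shifted X'' _ (λ j → e j + e' j)
    shifted'' = translate shifted' v'
    sum≢0 : ∀ j → j < n → e j + e' j ≢ 0ℤ
    sum≢0 j j<n sum≡0 = apart j j<n (≋-trans (antipodal-twice {X j} (proj₂ (proj₂ (v j))) (proj₂ (proj₂ (v' j))))
                                             (≋-reflexive (trans (cong (_+_ (X j)) sum≡0) (ℤ.+-identityʳ (X j)))))
    sign-change : TakesBothSigns e → ⊥
    sign-change ((j₋ , j₋<n , e≡-1) , (j₊ , j₊<n , e≡1)) =
      no-sign-change surjective'' antipodal'' shifted''
        (λ j j<n → jolt-of-sum (offset j) (offset' j) (sum≢0 j j<n)) no-jump
        (j₋ , j₋<n , subst (λ a → Negative (a + e' j₋)) (sym e≡-1)
                       (-1+offset-negative (offset' j₋) (subst (λ a → a + e' j₋ ≢ 0ℤ) e≡-1 (sum≢0 j₋ j₋<n))))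
        (j₊ , j₊<n , subst (λ a → ¬ Negative (a + e' j₊)) (sym e≡1) (1+offset-nonnegative (offset' j₊)))
      where
      no-jump : ∀ {t} → suc t < k → e (od t) + e' (od t) ≡ -[1+ 1 ] → e (ev (suc t)) + e' (ev (suc t)) ≢ + 2
      no-jump {t} st<k sum≡-2 sum≡2 =
        let δ , offset-δ , step = odd-step shifted' antipodal' st<k
        in offset-odd-no-jump 6≤n offset-δ
             (subst₂ (λ b a → b + 1ℤ ≋ a + δ) (offset-sum-two (offset _) (offset' _) sum≡2)
                     (offset-sum-minus-two (offset _) (offset' _) sum≡-2) step)

  -- The offsets e from X to X' avoid the common offset δ₀ from X to X₂; if e takes both signs,
  -- then δ₀ = 0, so e ∈ {±1} and no-sign-change applies to X' itself.
  outer-row-aligned : ∀ {X X₂ X' y y₂} → Shifted X y (λ _ → 0ℤ) → Shifted X₂ y₂ (λ _ → 0ℤ) →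
    ColumnAntipodal X X₂ → ColumnAntipodal X X' → (∀ j → j < n → ¬ X' j ≋ X₂ j) →
    InjectiveOn X' → SurjectiveOn X' → RowAntipodal X' → Aligned X'
  outer-row-aligned {X} {X₂} {X'} {y} {y₂} shifted shifted₂ v₂ v apart injective surjective antipodal =
    [ id , ⊥-elim ∘ sign-change ] (aligned-or-both-signs injective shifted' offset)
    where
    e : ℕ → ℤ
    e j = proj₁ (v j)
    offset : ∀ j → Offset (e j)
    offset j = proj₁ (proj₂ (v j))
    shifted' : Shifted X' _ e
    shifted' = rebase 0ℤ e (λ _ _ → refl) (translate shifted v)
    δ₀ : ℤ
    δ₀ = proj₁ (v₂ 0)
    gap : y₂ - y ≋ + k + δ₀
    gap = +-cancelˡ-≋ (X 0) (begin
      X 0 + (y₂ - y)   ≈⟨ aligned-difference shifted shifted₂ 0 0<n ⟨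
      X₂ 0             ≈⟨ proj₂ (proj₂ (v₂ 0)) ⟩
      X 0 + + k + δ₀   ≡⟨ ℤ.+-assoc (X 0) (+ k) δ₀ ⟩
      X 0 + (+ k + δ₀) ∎)
      where 0<n = ℕ.<-≤-trans (s≤s z≤n) 6≤n
    avoids-δ₀ : ∀ j → j < n → e j ≢ δ₀
    avoids-δ₀ j j<n e≡δ₀ = apart j j<n (begin
      X' j             ≈⟨ proj₂ (proj₂ (v j)) ⟩
      X j + + k + e j  ≡⟨ trans (ℤ.+-assoc (X j) (+ k) (e j)) (cong (λ d → X j + (+ k + d)) e≡δ₀) ⟩
      X j + (+ k + δ₀) ≈⟨ +-congˡ (X j) gap ⟨
      X j + (y₂ - y)   ≈⟨ aligned-difference shifted shifted₂ j j<n ⟨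
      X₂ j             ∎)
    sign-change : TakesBothSigns e → ⊥
    sign-change ((j₋ , j₋<n , e≡-1) , (j₊ , j₊<n , e≡1)) =
      no-sign-change surjective antipodal shifted'
        (λ j j<n → jolt-of-nonzero (offset j) λ e≡0 → avoids-δ₀ j j<n (trans e≡0 (sym δ₀≡0)))
        (λ _ e≡-2 _ → offset-≢-2 (offset _) e≡-2)
        (j₋ , j₋<n , subst Negative (sym e≡-1) _)
        (j₊ , j₊<n , subst (¬_ ∘ Negative) (sym e≡1) λ ())
      where
      δ₀≡0 : δ₀ ≡ 0ℤ
      δ₀≡0 = offset-≢±1⇒≡0 (proj₁ (proj₂ (v₂ 0))) (λ δ₀≡-1 → avoids-δ₀ j₋ j₋<n (trans e≡-1 (sym δ₀≡-1)))
                                                (λ δ₀≡1 → avoids-δ₀ j₊ j₊<n (trans e≡1 (sym δ₀≡1)))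

module LatinRows (k' : ℕ) where

  open Interleaving k'

  -- out-of-range indices go to row/column 0, so that rows are total functions on ℕ
  ix : ℕ → Fin n
  ix j with j ℕ.<? n
  ... | yes j<n = Fin.fromℕ< j<n
  ... | no  _   = Fin.zero

  toℕ-ix : ∀ {j} → j < n → Fin.toℕ (ix j) ≡ j
  toℕ-ix {j} j<n with j ℕ.<? n
  ... | yes j<n' = Fin.toℕ-fromℕ< j<n'
  ... | no  j≮n  = ⊥-elim (j≮n j<n)

  ix-toℕ : ∀ f → ix (Fin.toℕ f) ≡ f
  ix-toℕ f = Fin.toℕ-injective (toℕ-ix (Fin.toℕ<n f))

  ix-injective : ∀ {j j'} → j < n → j' < n → ix j ≡ ix j' → j ≡ j'
  ix-injective j<n j'<n eq = trans (sym (toℕ-ix j<n)) (trans (cong Fin.toℕ eq) (toℕ-ix j'<n))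

  toℕ-ix-suc : ∀ {j} → suc j < n → Fin.toℕ (ix (suc j)) ≡ suc (Fin.toℕ (ix j))
  toℕ-ix-suc sj<n = trans (toℕ-ix sj<n) (cong suc (sym (toℕ-ix (ℕ.<-trans (ℕ.n<1+n _) sj<n))))

  csuc-ix : ∀ {j} → suc j < n → csuc (ix j) ≡ ix (suc j)
  csuc-ix {j} sj<n with suc (Fin.toℕ (ix j)) ℕ.<? n
  ... | yes p = Fin.toℕ-injective (trans (Fin.toℕ-fromℕ< p) (sym (toℕ-ix-suc sj<n)))
  ... | no ¬p = ⊥-elim (¬p (subst (λ m → suc m < n) (sym (toℕ-ix (ℕ.<-trans (ℕ.n<1+n _) sj<n))) sj<n))

  rowA-ix : ∀ {j} → suc j < n → rowA n k (ix j) ≡ + (j ℕ.% 2)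
  rowA-ix {j} sj<n with suc (Fin.toℕ (ix j)) ℕ.<? n
  ... | yes _ = cong (λ m → + (m ℕ.% 2)) (toℕ-ix (ℕ.<-trans (ℕ.n<1+n _) sj<n))
  ... | no ¬p = ⊥-elim (¬p (subst (λ m → suc m < n) (sym (toℕ-ix (ℕ.<-trans (ℕ.n<1+n _) sj<n))) sj<n))

  module _ (L : Square n) (latin : IsLatin n L) (inner : InnerDistance n L (k ∸ 1)) where

    private
      open module ≋-Reasoning = Relation.Binary.Reasoning.Setoid ≋-setoid

      symbol-≋⇒≡ : ∀ {a b} → 1 ≤ a → a ≤ n → 1 ≤ b → b ≤ n → + a ≋ + b → a ≡ b
      symbol-≋⇒≡ 1≤a a≤n 1≤b b≤n =
        +≋+⇒≡ (ℕ.≤-<-trans a≤n (ℕ.m<m+n n 1≤b)) (ℕ.≤-<-trans b≤n (ℕ.m<m+n n 1≤a))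

      entries-≋⇒≡ : ∀ {i f i' f'} → + L i f ≋ + L i' f' → L i f ≡ L i' f'
      entries-≋⇒≡ {i} {f} {i'} {f'} =
        let 1≤a , a≤n = proj₁ latin i f ; 1≤b , b≤n = proj₁ latin i' f' in symbol-≋⇒≡ 1≤a a≤n 1≤b b≤n

      row-unique : ∀ i {f f'} → L i f ≡ L i f' → f ≡ f'
      row-unique i {f} {f'} eq =
        let 1≤s , s≤n = proj₁ latin i f ; _ , _ , unique = proj₁ (proj₂ latin) i (L i f) 1≤s s≤n
        in trans (unique f refl) (sym (unique f' (sym eq)))

      column-unique : ∀ f {i i'} → L i f ≡ L i' f → i ≡ i'
      column-unique f {i} {i'} eq =
        let 1≤s , s≤n = proj₁ latin i f ; _ , _ , unique = proj₂ (proj₂ latin) f (L i f) 1≤s s≤n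
        in trans (unique i refl) (sym (unique i' (sym eq)))

    W : ℕ → ℕ → ℤ
    W r j = + L (ix r) (ix j)

    row-injective : ∀ r → InjectiveOn (W r)
    row-injective r j<n j'<n Wj≋Wj' = ix-injective j<n j'<n (row-unique (ix r) (entries-≋⇒≡ Wj≋Wj'))

    row-surjective : ∀ r → SurjectiveOn (W r)
    row-surjective r z =
      let s = suc ((z - 1ℤ) %ℕ n)
          f , Lf≡s , _ = proj₁ (proj₂ latin) (ix r) s (s≤s z≤n) (n%ℕd<d (z - 1ℤ) n)
      in Fin.toℕ f , Fin.toℕ<n f , (begin
        W r (Fin.toℕ f)              ≡⟨ cong (λ f → + L (ix r) f) (ix-toℕ f) ⟩
        + L (ix r) f                 ≡⟨ cong +_ Lf≡s ⟩
        1ℤ + + ((z - 1ℤ) %ℕ n)       ≈⟨ +-congˡ 1ℤ (%ℕ-≋ (z - 1ℤ)) ⟩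
        1ℤ + (z - 1ℤ)                ≡⟨ cancel z ⟩
        z                            ∎)
      where cancel : ∀ z → 1ℤ + (z - 1ℤ) ≡ z
            cancel = solve-∀

    rows-apart : ∀ {r r'} → r < n → r' < n → r ≢ r' → ∀ j → j < n → ¬ W r j ≋ W r' j
    rows-apart r<n r'<n r≢r' j _ Wr≋Wr' =
      r≢r' (ix-injective r<n r'<n (column-unique (ix j) (entries-≋⇒≡ Wr≋Wr')))

    row-antipodal : ∀ r → RowAntipodal (W r)
    row-antipodal r j sj<n = near-antipodal-of-dist _ _
      (proj₁ inner (ix r) (ix j) (ix r) (ix (suc j)) (inj₁ (refl , toℕ-ix-suc sj<n)))

    column-antipodal : ∀ {r} → suc r < n → ColumnAntipodal (W r) (W (suc r))
    column-antipodal {r} sr<n j = near-antipodal-of-dist _ _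
      (proj₁ inner (ix r) (ix j) (ix (suc r)) (ix j) (inj₂ (refl , toℕ-ix-suc sr<n)))

    module _ (i₀ : Fin n) (row-A : ∀ j → extDiff n k (L i₀) j ≡ rowA n k j) where

      private
        r₀ : ℕ
        r₀ = Fin.toℕ i₀

        W-toℕ : ∀ i f → W (Fin.toℕ i) (Fin.toℕ f) ≡ + L i f
        W-toℕ i f = cong₂ (λ i f → + L i f) (ix-toℕ i) (ix-toℕ f)

        r≢r+2 : ∀ r → r ≢ suc (suc r)
        r≢r+2 r eq = ℕ.<-irrefl eq (ℕ.<-trans (ℕ.n<1+n r) (ℕ.n<1+n (suc r)))

        0<n : 0 < n
        0<n = ℕ.<-≤-trans (s≤s z≤n) 6≤n

        1<n : 1 < n
        1<n = ℕ.<-≤-trans (s≤s (s≤s z≤n)) 6≤n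

        2<n : 2 < n
        2<n = ℕ.<-≤-trans (s≤s (s≤s (s≤s z≤n))) 6≤n

        3<n : 3 < n
        3<n = ℕ.<-≤-trans (s≤s (s≤s (s≤s (s≤s z≤n)))) 6≤n

      row-A-difference : ∀ j → suc j < n → + L i₀ (ix (suc j)) - + L i₀ (ix j) ≋ + k + + (j ℕ.% 2)
      row-A-difference j sj<n = begin
        + L i₀ (ix (suc j)) - + L i₀ (ix j)           ≈⟨ %ℕ-≋ _ ⟨
        + resid n (L i₀ (ix (suc j))) (L i₀ (ix j))    ≡⟨ cong (λ f → + resid n (L i₀ f) (L i₀ (ix j))) (csuc-ix sj<n) ⟨
        + resid n (L i₀ (csuc (ix j))) (L i₀ (ix j))   ≡⟨ split (+ k) _ ⟩
        + k + extDiff n k (L i₀) (ix j)                ≡⟨ cong (_+_ (+ k)) (trans (row-A (ix j)) (rowA-ix sj<n)) ⟩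
        + k + + (j ℕ.% 2)                              ∎
        where split : ∀ k d → d ≡ k + (d - k)
              split = solve-∀

      pattern-step : ∀ j → suc j < n → W r₀ (suc j) ≋ W r₀ j + + k + + (j ℕ.% 2)
      pattern-step j sj<n = begin
        W r₀ (suc j)                  ≡⟨ split (W r₀ j) (W r₀ (suc j)) ⟩
        W r₀ j + (W r₀ (suc j) - W r₀ j)
          ≡⟨ cong (λ i → W r₀ j + (+ L i (ix (suc j)) - + L i (ix j))) (ix-toℕ i₀) ⟩
        W r₀ j + (+ L i₀ (ix (suc j)) - + L i₀ (ix j))
          ≈⟨ +-congˡ (W r₀ j) (row-A-difference j sj<n) ⟩
        W r₀ j + (+ k + + (j ℕ.% 2))  ≡⟨ ℤ.+-assoc (W r₀ j) (+ k) (+ (j ℕ.% 2)) ⟨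
        W r₀ j + + k + + (j ℕ.% 2)    ∎
        where split : ∀ b a → a ≡ b + (a - b)
              split = solve-∀

      pattern-row-aligned : Aligned (W r₀)
      pattern-row-aligned = _ , alternating-shifted pattern-step

      aligned-below : ∀ {r} → suc (suc r) < n → Aligned (W r) → Aligned (W (suc r))
      aligned-below {r} ssr<n (_ , shifted) =
        middle-row-aligned shifted (column-antipodal sr<n) (column-antipodal ssr<n)
          (rows-apart ssr<n r<n (r≢r+2 r ∘ sym))
          (row-injective (suc r)) (row-antipodal (suc r)) (row-surjective (suc (suc r))) (row-antipodal (suc (suc r)))
        where sr<n = ℕ.<-trans (ℕ.n<1+n _) ssr<n
              r<n  = ℕ.<-trans (ℕ.n<1+n _) sr<n

      aligned-above : ∀ {r} → suc (suc r) < n → Aligned (W (suc (suc r))) → Aligned (W (suc r))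
      aligned-above {r} ssr<n (_ , shifted) =
        middle-row-aligned shifted
          (near-antipodal-sym ∘ column-antipodal ssr<n) (near-antipodal-sym ∘ column-antipodal sr<n)
          (rows-apart r<n ssr<n (r≢r+2 r))
          (row-injective (suc r)) (row-antipodal (suc r)) (row-surjective r) (row-antipodal r)
        where sr<n = ℕ.<-trans (ℕ.n<1+n _) ssr<n
              r<n  = ℕ.<-trans (ℕ.n<1+n _) sr<n

      aligned-downwards : ∀ {r} → r₀ ℕ.≤′ r → suc r < n → Aligned (W r)
      aligned-downwards ℕ.≤′-refl      _    = pattern-row-aligned
      aligned-downwards (ℕ.≤′-step le) sr<n =
        aligned-below sr<n (aligned-downwards le (ℕ.<-trans (ℕ.n<1+n _) sr<n))

      aligned-upwards : ∀ d {r} → suc r ℕ.+ d ≡ r₀ → Aligned (W (suc r))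
      aligned-upwards zero    {r} eq =
        subst (Aligned ∘ W) (trans (sym eq) (ℕ.+-identityʳ (suc r))) pattern-row-aligned
      aligned-upwards (suc d) {r} eq = aligned-above ssr<n (aligned-upwards d (trans (sym (ℕ.+-suc (suc r) d)) eq))
        where ssr<n = ℕ.≤-<-trans (ℕ.≤-trans (ℕ.m≤m+n (suc (suc r)) d)
                                             (ℕ.≤-reflexive (trans (sym (ℕ.+-suc (suc r) d)) eq)))
                                  (Fin.toℕ<n i₀)

      aligned-interior : ∀ r → suc (suc r) < n → Aligned (W (suc r))
      aligned-interior r ssr<n with ℕ.≤-total r₀ (suc r)
      ... | inj₁ r₀≤sr = aligned-downwards (ℕ.≤⇒≤′ r₀≤sr) ssr<n
      ... | inj₂ sr≤r₀ = aligned-upwards (r₀ ∸ suc r) (ℕ.m+[n∸m]≡n sr≤r₀)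

      aligned : ∀ r → r < n → Aligned (W r)
      aligned 0 _ =
        outer-row-aligned (proj₂ (aligned-interior 0 2<n)) (proj₂ (aligned-interior 1 3<n))
          (column-antipodal 2<n) (near-antipodal-sym ∘ column-antipodal 1<n) (rows-apart 0<n 2<n (r≢r+2 0))
          (row-injective 0) (row-surjective 0) (row-antipodal 0)
      aligned 1 _ = aligned-interior 0 2<n
      aligned 2 _ = aligned-interior 1 3<n
      aligned (suc (suc (suc r))) sssr<n =
        outer-row-aligned (proj₂ (aligned-interior (suc r) sssr<n)) (proj₂ (aligned-interior r ssr<n))
          (near-antipodal-sym ∘ column-antipodal ssr<n) (column-antipodal sssr<n)
          (rows-apart sssr<n sr<n (r≢r+2 (suc r) ∘ sym))
          (row-injective (suc (suc (suc r)))) (row-surjective (suc (suc (suc r)))) (row-antipodal (suc (suc (suc r))))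
        where ssr<n = ℕ.<-trans (ℕ.n<1+n _) sssr<n
              sr<n  = ℕ.<-trans (ℕ.n<1+n _) ssr<n

      -- aligned rows agree on the difference of any two columns, adjacent or not
      row-product : IsRowProduct n L
      row-product i i' j j' _ = %ℕ-cong (≋-trans (difference i) (≋-sym (difference i')))
        where
        difference : ∀ i → + L i j' - + L i j ≋ + pos (Fin.toℕ j') - + pos (Fin.toℕ j)
        difference i = ≋-trans (≋-reflexive (cong₂ _-_ (sym (W-toℕ i j')) (sym (W-toℕ i j))))
          (shifted-difference (proj₂ (aligned (Fin.toℕ i) (Fin.toℕ<n i))) (Fin.toℕ<n j) (Fin.toℕ<n j'))

mainTheorem17 : (n k : ℕ) → n ≡ 2 * k → 3 ≤ k →
    (L : Square n) → IsLatin n L →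
    InnerDistance n L (k ∸ 1) →
    (∃[ i ] (∀ j → extDiff n k (L i) j ≡ rowA n k j)) →
    IsRowProduct n L
mainTheorem17 .(2 * suc (suc (suc k'))) (suc (suc (suc k'))) refl (s≤s (s≤s (s≤s z≤n))) L latin inner (i₀ , row-A) =
  LatinRows.row-product k' L latin inner i₀ row-A
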